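{- For every integer $k\geq 1$, the set of removable edges of the staircase $S_k$ is exactly $\{u_iv_i: 1\leq i\leq k\}$.
   Context: All graphs are finite, simple and undirected. A connected graph is matching covered if every edge lies in some perfect matching; an edge $e$ of a matching covered graph $G$ is removable if $G-e$ is matching covered. For $k\geq 1$, let $P_1=uu_1u_2\cdots u_kx$ and $P_2=vv_1v_2\cdots v_ky$ be vertex-disjoint paths; the staircase $S_k$ is obtained from $P_1\cup P_2$ by adding two new vertices $w,z$ and the edges $uv,uw,vw,xy,xz,yz,wz$ and $u_iv_i$ for $1\leq i\leq k$. -}

module Defs where

open import Data.Nat using (ℕ; suc)
open import Data.Fin using (Fin; toℕ)
open import Data.Product using (Σ; _×_; ∃)
open import Data.Sum using (_⊎_)
open import Relation.Nullary using (¬_)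
open import Relation.Binary.PropositionalEquality using (_≡_)
open import Relation.Binary.Construct.Closure.ReflexiveTransitive using (Star)

-- A graph is given by a vertex type V and an (undirected, simple) adjacency
-- relation E : V → V → Set.

Connected : {V : Set} → (V → V → Set) → Set
Connected {V} E = (a b : V) → Star E a b

-- A perfect matching, represented as its partner map: every vertex is matched
-- along an edge, and matching is symmetric (m is an involution).
IsPerfectMatching : {V : Set} → (V → V → Set) → (V → V) → Set
IsPerfectMatching {V} E m = ((a : V) → E a (m a)) × ((a : V) → m (m a) ≡ a)

MatchingCovered : {V : Set} → (V → V → Set) → Set
MatchingCovered {V} E =
  Connected E ×
  ((a b : V) → E a b → Σ (V → V) (λ m → IsPerfectMatching E m × m a ≡ b))

SamePair : {V : Set} → V → V → V → V → Set
SamePair x y a b = (x ≡ a × y ≡ b) ⊎ (x ≡ b × y ≡ a)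

DeleteEdge : {V : Set} → (V → V → Set) → V → V → (V → V → Set)
DeleteEdge E a b x y = E x y × ¬ SamePair x y a b

Removable : {V : Set} → (V → V → Set) → V → V → Set
Removable E a b = MatchingCovered E × E a b × MatchingCovered (DeleteEdge E a b)

-- Vertices of the staircase S_k; ui i, vi i (i : Fin k) stand for u_{i+1}, v_{i+1}.
data SVertex (k : ℕ) : Set where
  u v w z x y : SVertex k
  ui vi : Fin k → SVertex k

-- The listed edges of S_k (one orientation each).
data SBase (k : ℕ) : SVertex k → SVertex k → Set where
  e-uv : SBase k u v
  e-uw : SBase k u w
  e-vw : SBase k v w
  e-xy : SBase k x y
  e-xz : SBase k x z
  e-yz : SBase k y z
  e-wz : SBase k w z
  e-rung : (i : Fin k) → SBase k (ui i) (vi i)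
  e-u-first : (i : Fin k) → toℕ i ≡ 0 → SBase k u (ui i)
  e-u-step : (i j : Fin k) → toℕ j ≡ suc (toℕ i) → SBase k (ui i) (ui j)
  e-u-last : (i : Fin k) → suc (toℕ i) ≡ k → SBase k (ui i) x
  e-v-first : (i : Fin k) → toℕ i ≡ 0 → SBase k v (vi i)
  e-v-step : (i j : Fin k) → toℕ j ≡ suc (toℕ i) → SBase k (vi i) (vi j)
  e-v-last : (i : Fin k) → suc (toℕ i) ≡ k → SBase k (vi i) y

Staircase : (k : ℕ) → SVertex k → SVertex k → Set
Staircase k a b = SBase k a b ⊎ SBase k b a

-- Number the rails u = u₀, u₁, …, u_{k+1} = x and v = v₀, …, v_{k+1} = y.
-- A perfect matching of S_k that does not use wz matches w to u₀ or v₀, and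
-- is then forced level by level: at each level exactly one of u_n, v_n is
-- matched upwards, the side alternating, and z is matched to the top vertex
-- on the side that rises last.  So after deleting any edge other than an
-- inner rung some edge (a neighbouring rung, an edge at w or at z) lies in
-- no perfect matching of what is left.  Conversely the two zigzags, the
-- matching of all rungs and the matchings through one square
-- u_m u_{m+1} v_{m+1} v_m together cover every edge while avoiding a
-- prescribed inner rung, and the rails keep S_k − u_iv_i connected.
module Submission where

open import Defs
open import Data.Nat using (ℕ; zero; suc; _≤_; _<_; z≤n; s≤s; _≟_; _<?_)
open import Data.Nat.Properties
  using (≤-refl; ≤-antisym; ≤-pred; <⇒≤; m≤n⇒m≤1+n; ≮⇒≥; ≤∧≢⇒<; 1+n≢n; n≮n)
open import Data.Fin using (Fin; toℕ; fromℕ<)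
open import Data.Fin.Properties using (toℕ<n; toℕ-fromℕ<; fromℕ<-toℕ)
open import Data.Product using (Σ; ∃; _×_; _,_; proj₁; proj₂) renaming (map to map×)
open import Data.Sum using (_⊎_; inj₁; inj₂; swap) renaming (map to map⊎)
open import Data.Unit using (⊤; tt)
open import Data.Empty using (⊥-elim)
open import Function using (_∘_)
open import Function.Bundles using (_⇔_; mk⇔)
open import Relation.Nullary using (¬_; yes; no)
open import Relation.Binary.Definitions using (DecidableEquality)
open import Relation.Binary.PropositionalEquality
  using (_≡_; _≢_; refl; sym; trans; cong; subst; subst₂; module ≡-Reasoning)
open import Relation.Binary.Construct.Closure.ReflexiveTransitive
  using (Star; ε; _◅_; _◅◅_; reverse) renaming (map to mapStar)

samePair-map : {A B : Set} (f : A → B) {a b c d : A} →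
               SamePair a b c d → SamePair (f a) (f b) (f c) (f d)
samePair-map f = map⊎ (map× (cong f) (cong f)) (map× (cong f) (cong f))

samePair-injective : {A B : Set} {f : A → B} → (∀ {x y} → f x ≡ f y → x ≡ y) →
                     {a b c d : A} → SamePair (f a) (f b) (f c) (f d) → SamePair a b c d
samePair-injective inj = map⊎ (map× inj inj) (map× inj inj)

module _ {V : Set} {a b c d : V} where

  samePair-swap : SamePair a b c d → SamePair b a c d
  samePair-swap (inj₁ (p , q)) = inj₂ (q , p)
  samePair-swap (inj₂ (p , q)) = inj₁ (q , p)

  samePair-comm : SamePair a b c d → SamePair a b d c
  samePair-comm = swap

connected-mono : {V : Set} {E F : V → V → Set} → (∀ {a b} → E a b → F a b) →
                 Connected E → Connected F
connected-mono f conn a b = mapStar f (conn a b)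

connected-via : {V : Set} {E : V → V → Set} → (∀ {a b} → E a b → E b a) →
                (o : V) → (∀ a → Star E a o) → Connected E
connected-via E-sym o walk a b = walk a ◅◅ reverse E-sym (walk b)

matchingCovered-cong : {V : Set} {E F : V → V → Set} →
                       (∀ {a b} → E a b → F a b) → (∀ {a b} → F a b → E a b) →
                       MatchingCovered E → MatchingCovered F
matchingCovered-cong f g (conn , covered) =
  connected-mono f conn ,
  λ a b e → let m , (edge , inv) , hit = covered a b (g e) in m , (f ∘ edge , inv) , hit

module _ {V : Set} {E : V → V → Set} where

  deleteEdge-comm : ∀ {a b c d} → DeleteEdge E a b c d → DeleteEdge E b a c d
  deleteEdge-comm (e , ne) = e , ne ∘ samePair-comm

  deleteEdge-sym : (∀ {c d} → E c d → E d c) →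
                   ∀ {a b c d} → DeleteEdge E a b c d → DeleteEdge E a b d c
  deleteEdge-sym E-sym (e , ne) = E-sym e , ne ∘ samePair-swap

  removable-sym : (∀ {c d} → E c d → E d c) → ∀ {a b} → Removable E a b → Removable E b a
  removable-sym E-sym (mc , e , mc-e) =
    mc , E-sym e , matchingCovered-cong deleteEdge-comm deleteEdge-comm mc-e

  perfectMatching-deleteEdge⁻ : ∀ {a b m} → IsPerfectMatching (DeleteEdge E a b) m →
                                IsPerfectMatching E m × m a ≢ b × m b ≢ a
  perfectMatching-deleteEdge⁻ {a} {b} (edge , inv) =
    (proj₁ ∘ edge , inv) ,
    (λ ma≡b → proj₂ (edge a) (inj₁ (refl , ma≡b))) ,
    (λ mb≡a → proj₂ (edge b) (inj₂ (refl , mb≡a)))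

  perfectMatching-deleteEdge : ∀ {a b m} → IsPerfectMatching E m → m a ≢ b →
                               IsPerfectMatching (DeleteEdge E a b) m
  perfectMatching-deleteEdge {a} {b} {m} (edge , inv) ma≢b = (λ c → edge c , avoids c) , inv
    where
    avoids : ∀ c → ¬ SamePair c (m c) a b
    avoids c (inj₁ (refl , mc≡b)) = ma≢b mc≡b
    avoids c (inj₂ (refl , mc≡a)) = ma≢b (trans (cong m (sym mc≡a)) (inv c))

data Side : Set where
  U V : Side

op : Side → Side
op U = V
op V = U

op-involutive : ∀ s → op (op s) ≡ s
op-involutive U = refl
op-involutive V = refl

s≢op : ∀ s → s ≢ op s
s≢op U ()
s≢op V ()

≢⇒≡op : ∀ {s t} → s ≢ t → s ≡ op t
≢⇒≡op {U} {U} s≢t = ⊥-elim (s≢t refl)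
≢⇒≡op {U} {V} _ = refl
≢⇒≡op {V} {U} _ = refl
≢⇒≡op {V} {V} s≢t = ⊥-elim (s≢t refl)

_≟ˢ_ : DecidableEquality Side
U ≟ˢ U = yes refl
V ≟ˢ V = yes refl
U ≟ˢ V = no λ ()
V ≟ˢ U = no λ ()

-- P U n and P V n are u_n and v_n, where u₀ = u, u_{k+1} = x, v₀ = v, v_{k+1} = y;
-- W and Z are w and z.
data Coord : Set where
  W Z : Coord
  P : Side → ℕ → Coord

P-injective : ∀ {s t n m} → P s n ≡ P t m → s ≡ t × n ≡ m
P-injective refl = refl , refl

U≢V : ∀ {n m} → P U n ≢ P V m
U≢V ()

W≢P : ∀ {s n} → W ≢ P s n
W≢P ()

Z≢P : ∀ {s n} → Z ≢ P s n
Z≢P ()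

-- The side whose vertex at level n is matched upwards in the zigzag matching
-- that starts with the rail edge at level 0 on side r.
riser : Side → ℕ → Side
riser r zero = r
riser r (suc n) = op (riser r n)

riser-onto : ∀ s n → ∃ λ r → riser r n ≡ s
riser-onto s zero = s , refl
riser-onto s (suc n) =
  let r , r↑ = riser-onto (op s) n in r , trans (cong op r↑) (op-involutive s)

module Ladder (k : ℕ) where

  Valid : Coord → Set
  Valid (P _ n) = n ≤ suc k
  Valid _ = ⊤

  data Adj : Coord → Coord → Set where
    rung : ∀ n → n ≤ suc k → Adj (P U n) (P V n)
    rail : ∀ s n → n ≤ k → Adj (P s n) (P s (suc n))
    w-end : ∀ s → Adj W (P s 0)
    z-end : ∀ s → Adj Z (P s (suc k))
    w-z : Adj W Z

  infix 4 _~_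
  _~_ : Coord → Coord → Set
  c ~ d = Adj c d ⊎ Adj d c

  adj-valid : ∀ {c d} → Adj c d → Valid c × Valid d
  adj-valid (rung n n≤1+k) = n≤1+k , n≤1+k
  adj-valid (rail s n n≤k) = m≤n⇒m≤1+n n≤k , s≤s n≤k
  adj-valid (w-end s) = tt , z≤n
  adj-valid (z-end s) = tt , ≤-refl
  adj-valid w-z = tt , tt

  ~-valid : ∀ {c d} → c ~ d → Valid d
  ~-valid (inj₁ e) = proj₂ (adj-valid e)
  ~-valid (inj₂ e) = proj₁ (adj-valid e)

  rung~ : ∀ s {n} → n ≤ suc k → P s n ~ P (op s) n
  rung~ U n≤1+k = inj₁ (rung _ n≤1+k)
  rung~ V n≤1+k = inj₂ (rung _ n≤1+k)

  rail-not-rung : ∀ {s n m p} → ¬ SamePair (P s n) (P s m) (P U p) (P V p)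
  rail-not-rung (inj₁ (refl , ()))
  rail-not-rung (inj₂ (refl , ()))

  w-neighbour : ∀ {d} → W ~ d → d ≡ P U 0 ⊎ d ≡ P V 0 ⊎ d ≡ Z
  w-neighbour (inj₁ (w-end U)) = inj₁ refl
  w-neighbour (inj₁ (w-end V)) = inj₂ (inj₁ refl)
  w-neighbour (inj₁ w-z) = inj₂ (inj₂ refl)

  z-neighbour : ∀ {d} → Z ~ d → d ≡ P U (suc k) ⊎ d ≡ P V (suc k) ⊎ d ≡ W
  z-neighbour (inj₁ (z-end U)) = inj₁ refl
  z-neighbour (inj₁ (z-end V)) = inj₂ (inj₁ refl)
  z-neighbour (inj₂ w-z) = inj₂ (inj₂ refl)

  bottom-neighbour : ∀ s {d} → P s 0 ~ d → d ≡ W ⊎ d ≡ P (op s) 0 ⊎ d ≡ P s 1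
  bottom-neighbour U (inj₁ (rung _ _)) = inj₂ (inj₁ refl)
  bottom-neighbour V (inj₂ (rung _ _)) = inj₂ (inj₁ refl)
  bottom-neighbour s (inj₁ (rail _ _ _)) = inj₂ (inj₂ refl)
  bottom-neighbour s (inj₂ (w-end _)) = inj₁ refl

  top-neighbour : ∀ s {d} → P s (suc k) ~ d → d ≡ Z ⊎ d ≡ P (op s) (suc k) ⊎ d ≡ P s k
  top-neighbour U (inj₁ (rung _ _)) = inj₂ (inj₁ refl)
  top-neighbour V (inj₂ (rung _ _)) = inj₂ (inj₁ refl)
  top-neighbour s (inj₁ (rail _ _ 1+k≤k)) = ⊥-elim (n≮n k 1+k≤k)
  top-neighbour s (inj₂ (rail _ _ _)) = inj₂ (inj₂ refl)
  top-neighbour s (inj₂ (z-end _)) = inj₁ refl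

  middle-neighbour : ∀ s {n d} → n < k → P s (suc n) ~ d →
                     d ≡ P (op s) (suc n) ⊎ d ≡ P s n ⊎ d ≡ P s (suc (suc n))
  middle-neighbour U _ (inj₁ (rung _ _)) = inj₁ refl
  middle-neighbour V _ (inj₂ (rung _ _)) = inj₁ refl
  middle-neighbour s _ (inj₁ (rail _ _ _)) = inj₂ (inj₂ refl)
  middle-neighbour s _ (inj₂ (rail _ _ _)) = inj₂ (inj₁ refl)
  middle-neighbour s n<k (inj₂ (z-end _)) = ⊥-elim (n≮n k n<k)

  record IsMatching (μ : Coord → Coord) : Set where
    field
      involutive : ∀ c → Valid c → μ (μ c) ≡ c
      adjacent : ∀ c → Valid c → c ~ μ c

  module Forced {μ : Coord → Coord} (M : IsMatching μ) where
    open IsMatching M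

    partner : ∀ {c d} → Valid c → μ c ≡ d → μ d ≡ c
    partner {c} vc refl = involutive c vc

    w-partner : ∀ s → μ W ≢ P s 0 → μ W ≢ Z → μ W ≡ P (op s) 0
    w-partner s w↛s w↛z with w-neighbour (adjacent W tt)
    w-partner U w↛s w↛z | inj₁ w↦ = ⊥-elim (w↛s w↦)
    w-partner V w↛s w↛z | inj₁ w↦ = w↦
    w-partner U w↛s w↛z | inj₂ (inj₁ w↦) = w↦
    w-partner V w↛s w↛z | inj₂ (inj₁ w↦) = ⊥-elim (w↛s w↦)
    w-partner _ w↛s w↛z | inj₂ (inj₂ w↦) = ⊥-elim (w↛z w↦)

    z-partner : ∀ s → μ Z ≢ P s (suc k) → μ Z ≢ W → μ Z ≡ P (op s) (suc k)
    z-partner s z↛s z↛w with z-neighbour (adjacent Z tt)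
    z-partner U z↛s z↛w | inj₁ z↦ = ⊥-elim (z↛s z↦)
    z-partner V z↛s z↛w | inj₁ z↦ = z↦
    z-partner U z↛s z↛w | inj₂ (inj₁ z↦) = z↦
    z-partner V z↛s z↛w | inj₂ (inj₁ z↦) = ⊥-elim (z↛s z↦)
    z-partner _ z↛s z↛w | inj₂ (inj₂ z↦) = ⊥-elim (z↛w z↦)

    bottom-to-w : ∀ s → μ (P s 0) ≢ P (op s) 0 → μ (P s 1) ≢ P s 0 → μ (P s 0) ≡ W
    bottom-to-w s ↛rung ↛rail with bottom-neighbour s (adjacent (P s 0) z≤n)
    ... | inj₁ e = e
    ... | inj₂ (inj₁ e) = ⊥-elim (↛rung e)
    ... | inj₂ (inj₂ e) = ⊥-elim (↛rail (partner z≤n e))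

    top-to-z : ∀ s → μ (P s (suc k)) ≢ P (op s) (suc k) → μ (P s k) ≢ P s (suc k) →
               μ (P s (suc k)) ≡ Z
    top-to-z s ↛rung ↛rail with top-neighbour s (adjacent (P s (suc k)) ≤-refl)
    ... | inj₁ e = e
    ... | inj₂ (inj₁ e) = ⊥-elim (↛rung e)
    ... | inj₂ (inj₂ e) = ⊥-elim (↛rail (partner ≤-refl e))

    avoid-uv⇒avoid-rung₁ : μ (P U 0) ≢ P V 0 → μ (P V 0) ≢ P U 0 → μ (P U 1) ≢ P V 1
    avoid-uv⇒avoid-rung₁ u↛v v↛u rung₁ = U≢V (trans (sym (partner z≤n u↦w)) (partner z≤n v↦w))
      where
      u↦w : μ (P U 0) ≡ W
      u↦w = bottom-to-w U u↛v (λ e → U≢V (trans (sym e) rung₁))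
      v↦w : μ (P V 0) ≡ W
      v↦w = bottom-to-w V v↛u (λ e → U≢V (trans (sym (partner (s≤s z≤n) rung₁)) e))

    avoid-xy⇒avoid-rungₖ : μ (P U (suc k)) ≢ P V (suc k) → μ (P V (suc k)) ≢ P U (suc k) →
                           μ (P U k) ≢ P V k
    avoid-xy⇒avoid-rungₖ x↛y y↛x rungₖ = U≢V (trans (sym (partner ≤-refl x↦z)) (partner ≤-refl y↦z))
      where
      x↦z : μ (P U (suc k)) ≡ Z
      x↦z = top-to-z U x↛y (λ e → U≢V (trans (sym e) rungₖ))
      y↦z : μ (P V (suc k)) ≡ Z
      y↦z = top-to-z V y↛x (λ e → U≢V (trans (sym (partner (m≤n⇒m≤1+n ≤-refl) rungₖ)) e))

    avoid-wz⇒avoid-uv : μ W ≢ Z → μ (P U 0) ≢ P V 0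
    avoid-wz⇒avoid-uv w↛z uv with w-neighbour (adjacent W tt)
    ... | inj₁ w↦u = W≢P (trans (sym (partner tt w↦u)) uv)
    ... | inj₂ (inj₁ w↦v) = W≢P (trans (sym (partner tt w↦v)) (partner z≤n uv))
    ... | inj₂ (inj₂ w↦z) = w↛z w↦z

    Rises : Side → ℕ → Set
    Rises s n = μ (P s n) ≡ P s (suc n)

    RisesAlone : Side → ℕ → Set
    RisesAlone s n = Rises s n × ¬ Rises (op s) n

    rises-alone-bottom : ∀ r → μ W ≡ P (op r) 0 → RisesAlone r 0
    rises-alone-bottom r w↦ = rises , λ e → W≢P (trans (sym op↦w) e)
      where
      op↦w : μ (P (op r) 0) ≡ W
      op↦w = partner tt w↦
      rises : Rises r 0
      rises with bottom-neighbour r (adjacent (P r 0) z≤n)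
      ... | inj₁ e = ⊥-elim (s≢op r (proj₁ (P-injective (trans (sym (partner z≤n e)) w↦))))
      ... | inj₂ (inj₁ e) = ⊥-elim (W≢P (trans (sym op↦w) (partner z≤n e)))
      ... | inj₂ (inj₂ e) = e

    rises-alone-step : ∀ {r n} → n < k → RisesAlone r n → RisesAlone (op r) (suc n)
    rises-alone-step {r} {n} n<k (rises , op-stays) = op-rises , r-stays
      where
      v₁ : suc n ≤ suc k
      v₁ = m≤n⇒m≤1+n n<k
      r-falls : μ (P r (suc n)) ≡ P r n
      r-falls = partner (m≤n⇒m≤1+n (<⇒≤ n<k)) rises
      op-rises : Rises (op r) (suc n)
      op-rises with middle-neighbour (op r) n<k (adjacent (P (op r) (suc n)) v₁)
      ... | inj₁ e = ⊥-elim (s≢op r (proj₁ (P-injective (trans (sym r-falls) (rung-back e)))))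
        where
        rung-back : μ (P (op r) (suc n)) ≡ P (op (op r)) (suc n) → μ (P r (suc n)) ≡ P (op r) (suc n)
        rung-back e = subst (λ t → μ (P t (suc n)) ≡ P (op r) (suc n)) (op-involutive r) (partner v₁ e)
      ... | inj₂ (inj₁ e) = ⊥-elim (op-stays (partner v₁ e))
      ... | inj₂ (inj₂ e) = e
      r-stays : ¬ Rises (op (op r)) (suc n)
      r-stays rewrite op-involutive r = λ e → two-levels-apart (trans (sym r-falls) e)
        where
        two-levels-apart : P r n ≢ P r (suc (suc n))
        two-levels-apart ()

    rises-alone : ∀ {r} → μ W ≡ P (op r) 0 → ∀ n → n ≤ k → RisesAlone (riser r n) n
    rises-alone w↦ zero _ = rises-alone-bottom _ w↦
    rises-alone w↦ (suc n) n<k = rises-alone-step n<k (rises-alone w↦ n (<⇒≤ n<k))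

    z-forced : ∀ {r} → μ W ≡ P (op r) 0 → μ Z ≡ P (riser r (suc k)) (suc k)
    z-forced {r} w↦ = z-partner (riser r k) z↛top z↛w
      where
      z↛w : μ Z ≢ W
      z↛w e = Z≢P (trans (sym (partner tt e)) w↦)
      z↛top : μ Z ≢ P (riser r k) (suc k)
      z↛top e = Z≢P (trans (sym (partner tt e))
                  (partner (m≤n⇒m≤1+n ≤-refl) (proj₁ (rises-alone w↦ k ≤-refl))))

    avoid-w-end⇒avoid-z-end : ∀ s → μ W ≢ P s 0 → μ Z ≢ P (riser s k) (suc k)
    avoid-w-end⇒avoid-z-end s w↛s z↦ =
      s≢op (riser s k) (proj₁ (P-injective (trans (sym z↦) (z-forced w↦))))
      where
      w↦ : μ W ≡ P (op s) 0
      w↦ = w-partner s w↛s (λ w↦z → W≢P (trans (sym (partner tt w↦z)) z↦))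

    avoid-z-end⇒avoid-w-end : ∀ {r s} → riser r (suc k) ≡ s → μ Z ≢ P s (suc k) →
                              μ W ≢ P (op r) 0
    avoid-z-end⇒avoid-w-end r↑ z↛s w↦ = z↛s (trans (z-forced w↦) (cong (λ t → P t (suc k)) r↑))

    avoid-rail⇒avoid-w-end : ∀ {r s n} → riser r n ≡ s → n ≤ k → μ (P s n) ≢ P s (suc n) →
                             μ W ≢ P (op r) 0
    avoid-rail⇒avoid-w-end {n = n} r↑ n≤k ↛rail w↦ =
      ↛rail (subst (λ t → Rises t n) r↑ (proj₁ (rises-alone w↦ n n≤k)))

  record Obstruction (c d : Coord) : Set where
    field
      c′ d′ : Coord
      edge : c′ ~ d′
      distinct : ¬ SamePair c′ d′ c d
      blocked : ∀ {μ} → IsMatching μ → μ c ≢ d → μ d ≢ c → μ c′ ≢ d′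

  obstruction-sym : ∀ {c d} → Obstruction c d → Obstruction d c
  obstruction-sym o = record
    { c′ = c′ ; d′ = d′ ; edge = edge ; distinct = distinct ∘ samePair-comm
    ; blocked = λ M c↛d d↛c → blocked M d↛c c↛d }
    where open Obstruction o

  uv-obstruction : Obstruction (P U 0) (P V 0)
  uv-obstruction = record
    { c′ = P U 1 ; d′ = P V 1 ; edge = inj₁ (rung 1 (s≤s z≤n))
    ; distinct = λ { (inj₁ (() , _)) ; (inj₂ (() , _)) }
    ; blocked = λ M → Forced.avoid-uv⇒avoid-rung₁ M }

  xy-obstruction : Obstruction (P U (suc k)) (P V (suc k))
  xy-obstruction = record
    { c′ = P U k ; d′ = P V k ; edge = inj₁ (rung k (m≤n⇒m≤1+n ≤-refl))
    ; distinct = λ { (inj₁ (() , _)) ; (inj₂ (() , _)) }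
    ; blocked = λ M → Forced.avoid-xy⇒avoid-rungₖ M }

  wz-obstruction : Obstruction W Z
  wz-obstruction = record
    { c′ = P U 0 ; d′ = P V 0 ; edge = inj₁ (rung 0 z≤n)
    ; distinct = λ { (inj₁ (() , _)) ; (inj₂ (() , _)) }
    ; blocked = λ M w↛z _ → Forced.avoid-wz⇒avoid-uv M w↛z }

  w-end-obstruction : ∀ s → Obstruction W (P s 0)
  w-end-obstruction s = record
    { c′ = Z ; d′ = P (riser s k) (suc k) ; edge = inj₁ (z-end _)
    ; distinct = λ { (inj₁ (() , _)) ; (inj₂ (() , _)) }
    ; blocked = λ M w↛s _ → Forced.avoid-w-end⇒avoid-z-end M s w↛s }

  z-end-obstruction : ∀ s → Obstruction Z (P s (suc k))
  z-end-obstruction s with riser-onto s (suc k)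
  ... | r , r↑ = record
    { c′ = W ; d′ = P (op r) 0 ; edge = inj₁ (w-end _)
    ; distinct = λ { (inj₁ (() , _)) ; (inj₂ (() , _)) }
    ; blocked = λ M z↛s _ → Forced.avoid-z-end⇒avoid-w-end M r↑ z↛s }

  rail-obstruction : ∀ s n → n ≤ k → Obstruction (P s n) (P s (suc n))
  rail-obstruction s n n≤k with riser-onto s n
  ... | r , r↑ = record
    { c′ = W ; d′ = P (op r) 0 ; edge = inj₁ (w-end _)
    ; distinct = λ { (inj₁ (() , _)) ; (inj₂ (() , _)) }
    ; blocked = λ M ↛rail _ → Forced.avoid-rail⇒avoid-w-end M r↑ n≤k ↛rail }

  InnerRung : Coord → Coord → Set
  InnerRung c d = ∃ λ n → n < k × SamePair c d (P U (suc n)) (P V (suc n))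

  adj-inner-rung-or-obstruction : ∀ {c d} → Adj c d → InnerRung c d ⊎ Obstruction c d
  adj-inner-rung-or-obstruction (rung zero _) = inj₂ uv-obstruction
  adj-inner-rung-or-obstruction (rung (suc n) (s≤s n≤k)) with n <? k
  ... | yes n<k = inj₁ (n , n<k , inj₁ (refl , refl))
  ... | no n≮k rewrite ≤-antisym n≤k (≮⇒≥ n≮k) = inj₂ xy-obstruction
  adj-inner-rung-or-obstruction (rail s n n≤k) = inj₂ (rail-obstruction s n n≤k)
  adj-inner-rung-or-obstruction (w-end s) = inj₂ (w-end-obstruction s)
  adj-inner-rung-or-obstruction (z-end s) = inj₂ (z-end-obstruction s)
  adj-inner-rung-or-obstruction w-z = inj₂ wz-obstruction

  inner-rung-or-obstruction : ∀ {c d} → c ~ d → InnerRung c d ⊎ Obstruction c d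
  inner-rung-or-obstruction (inj₁ e) = adj-inner-rung-or-obstruction e
  inner-rung-or-obstruction (inj₂ e) =
    map⊎ (λ (n , n<k , sp) → n , n<k , samePair-swap sp) obstruction-sym
         (adj-inner-rung-or-obstruction e)

  rungs : Coord → Coord
  rungs W = Z
  rungs Z = W
  rungs (P s n) = P (op s) n

  rungs-isMatching : IsMatching rungs
  rungs-isMatching = record { involutive = involutive ; adjacent = adjacent }
    where
    involutive : ∀ c → Valid c → rungs (rungs c) ≡ c
    involutive W _ = refl
    involutive Z _ = refl
    involutive (P s n) _ = cong (λ t → P t n) (op-involutive s)
    adjacent : ∀ c → Valid c → c ~ rungs c
    adjacent W _ = inj₁ w-z
    adjacent Z _ = inj₂ w-z
    adjacent (P s n) n≤1+k = rung~ s n≤1+k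

  square : ℕ → Coord → Coord
  square m W = Z
  square m Z = W
  square m (P s n) with n ≟ m | n ≟ suc m
  ... | yes _ | _ = P s (suc n)
  ... | no _ | yes _ = P s m
  ... | no _ | no _ = P (op s) n

  square-lower : ∀ m s → square m (P s m) ≡ P s (suc m)
  square-lower m s with m ≟ m
  ... | yes _ = refl
  ... | no m≢m = ⊥-elim (m≢m refl)

  square-upper : ∀ m s → square m (P s (suc m)) ≡ P s m
  square-upper m s with suc m ≟ m | suc m ≟ suc m
  ... | yes 1+m≡m | _ = ⊥-elim (1+n≢n 1+m≡m)
  ... | no _ | yes _ = refl
  ... | no _ | no 1+m≢1+m = ⊥-elim (1+m≢1+m refl)

  square-rung : ∀ {m n} s → n ≢ m → n ≢ suc m → square m (P s n) ≡ P (op s) n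
  square-rung {m} {n} s n≢m n≢1+m with n ≟ m | n ≟ suc m
  ... | yes n≡m | _ = ⊥-elim (n≢m n≡m)
  ... | no _ | yes n≡1+m = ⊥-elim (n≢1+m n≡1+m)
  ... | no _ | no _ = refl

  square-isMatching : ∀ m → m ≤ k → IsMatching (square m)
  square-isMatching m m≤k = record { involutive = involutive ; adjacent = adjacent }
    where
    involutive : ∀ c → Valid c → square m (square m c) ≡ c
    involutive W _ = refl
    involutive Z _ = refl
    involutive (P s n) _ with n ≟ m | n ≟ suc m
    ... | yes refl | _ = square-upper m s
    ... | no _ | yes refl = square-lower m s
    ... | no n≢m | no n≢1+m = trans (square-rung (op s) n≢m n≢1+m) (cong (λ t → P t n) (op-involutive s))
    adjacent : ∀ c → Valid c → c ~ square m c
    adjacent W _ = inj₁ w-z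
    adjacent Z _ = inj₂ w-z
    adjacent (P s n) n≤1+k with n ≟ m | n ≟ suc m
    ... | yes refl | _ = inj₁ (rail s m m≤k)
    ... | no _ | yes refl = inj₂ (rail s m m≤k)
    ... | no _ | no _ = rung~ s n≤1+k

  square-avoids-lower : ∀ m → square m (P U m) ≢ P V m
  square-avoids-lower m e = U≢V (trans (sym (square-lower m U)) e)

  square-avoids-upper : ∀ m → square m (P U (suc m)) ≢ P V (suc m)
  square-avoids-upper m e = U≢V (trans (sym (square-upper m U)) e)

  above : Side → ℕ → Coord
  above s n with n ≟ suc k
  ... | yes _ = Z
  ... | no _ = P s (suc n)

  below : Side → ℕ → Coord
  below s zero = W
  below s (suc n) = P s n

  above-top : ∀ s → above s (suc k) ≡ Z
  above-top s with suc k ≟ suc k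
  ... | yes _ = refl
  ... | no 1+k≢1+k = ⊥-elim (1+k≢1+k refl)

  above-rail : ∀ s {n} → n ≤ k → above s n ≡ P s (suc n)
  above-rail s {n} n≤k with n ≟ suc k
  ... | yes refl = ⊥-elim (n≮n k n≤k)
  ... | no _ = refl

  above~ : ∀ s {n} → n ≤ suc k → P s n ~ above s n
  above~ s {n} n≤1+k with n ≟ suc k
  ... | yes refl = inj₂ (z-end s)
  ... | no n≢1+k = inj₁ (rail s n (≤-pred (≤∧≢⇒< n≤1+k n≢1+k)))

  below~ : ∀ s {n} → n ≤ suc k → P s n ~ below s n
  below~ s {zero} _ = inj₂ (w-end s)
  below~ s {suc n} 1+n≤1+k = inj₂ (rail s n (≤-pred 1+n≤1+k))

  zigzag : Side → Coord → Coord
  zigzag r W = P (op r) 0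
  zigzag r Z = P (riser r (suc k)) (suc k)
  zigzag r (P s n) with s ≟ˢ riser r n
  ... | yes _ = above s n
  ... | no _ = below s n

  zigzag-rises : ∀ r {s n} → s ≡ riser r n → zigzag r (P s n) ≡ above s n
  zigzag-rises r {s} {n} s≡ with s ≟ˢ riser r n
  ... | yes _ = refl
  ... | no s≢ = ⊥-elim (s≢ s≡)

  zigzag-falls : ∀ r {s n} → s ≢ riser r n → zigzag r (P s n) ≡ below s n
  zigzag-falls r {s} {n} s≢ with s ≟ˢ riser r n
  ... | yes s≡ = ⊥-elim (s≢ s≡)
  ... | no _ = refl

  zigzag-isMatching : ∀ r → IsMatching (zigzag r)
  zigzag-isMatching r = record { involutive = involutive ; adjacent = adjacent }
    where
    rise-fall : ∀ n → zigzag r (above (riser r n) n) ≡ P (riser r n) n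
    rise-fall n with n ≟ suc k
    ... | yes refl = refl
    ... | no _ = zigzag-falls r (s≢op (riser r n))
    fall-rise : ∀ {s} n → n ≤ suc k → s ≢ riser r n → zigzag r (below s n) ≡ P s n
    fall-rise zero _ s≢r = cong (λ t → P t 0) (sym (≢⇒≡op s≢r))
    fall-rise {s} (suc n) 1+n≤1+k s≢ =
      trans (zigzag-rises r (trans (≢⇒≡op s≢) (op-involutive _))) (above-rail s (≤-pred 1+n≤1+k))
    involutive : ∀ c → Valid c → zigzag r (zigzag r c) ≡ c
    involutive W _ = zigzag-falls r (s≢op r ∘ sym)
    involutive Z _ = trans (zigzag-rises r refl) (above-top _)
    involutive (P s n) n≤1+k with s ≟ˢ riser r n
    ... | yes refl = rise-fall n
    ... | no s≢ = fall-rise n n≤1+k s≢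
    adjacent : ∀ c → Valid c → c ~ zigzag r c
    adjacent W _ = inj₁ (w-end (op r))
    adjacent Z _ = inj₁ (z-end _)
    adjacent (P s n) n≤1+k with s ≟ˢ riser r n
    ... | yes _ = above~ s n≤1+k
    ... | no _ = below~ s n≤1+k

  zigzag-avoids : ∀ r n → zigzag r (P U n) ≢ P V n
  zigzag-avoids r n with U ≟ˢ riser r n
  ... | yes _ = above-avoids n
    where
    above-avoids : ∀ n → above U n ≢ P V n
    above-avoids n with n ≟ suc k
    ... | yes _ = λ ()
    ... | no _ = λ ()
  ... | no _ = below-avoids n
    where
    below-avoids : ∀ n → below U n ≢ P V n
    below-avoids zero ()
    below-avoids (suc n) ()

  zigzag-rail : ∀ s n → n ≤ k → ∃ λ r → zigzag r (P s n) ≡ P s (suc n)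
  zigzag-rail s n n≤k =
    let r , r↑ = riser-onto s n in r , trans (zigzag-rises r (sym r↑)) (above-rail s n≤k)

  zigzag-w-end : ∀ s → zigzag (op s) W ≡ P s 0
  zigzag-w-end s = cong (λ t → P t 0) (op-involutive s)

  zigzag-z-end : ∀ s → ∃ λ r → zigzag r Z ≡ P s (suc k)
  zigzag-z-end s = let r , r↑ = riser-onto s (suc k) in r , cong (λ t → P t (suc k)) r↑

  Through : ((Coord → Coord) → Set) → Coord → Coord → Set
  Through Q c d = Σ (Coord → Coord) λ μ → IsMatching μ × Q μ × μ c ≡ d

  through-sym : ∀ {Q c d} → Valid c → Through Q c d → Through Q d c
  through-sym vc (μ , M , q , hit) = μ , M , q , Forced.partner M vc hit

  AvoidsRung : ℕ → (Coord → Coord) → Set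
  AvoidsRung p μ = μ (P U p) ≢ P V p

  adj-through : ∀ {c d} → Adj c d → Through (λ _ → ⊤) c d
  adj-through (rung n _) = rungs , rungs-isMatching , tt , refl
  adj-through (rail s n n≤k) =
    let r , hit = zigzag-rail s n n≤k in zigzag r , zigzag-isMatching r , tt , hit
  adj-through (w-end s) = zigzag (op s) , zigzag-isMatching (op s) , tt , zigzag-w-end s
  adj-through (z-end s) =
    let r , hit = zigzag-z-end s in zigzag r , zigzag-isMatching r , tt , hit
  adj-through w-z = rungs , rungs-isMatching , tt , refl

  through : ∀ {c d} → c ~ d → Through (λ _ → ⊤) c d
  through (inj₁ e) = adj-through e
  through (inj₂ e) = through-sym (proj₁ (adj-valid e)) (adj-through e)

  adj-through-avoiding : ∀ {j c d} → j < k → Adj c d → ¬ SamePair c d (P U (suc j)) (P V (suc j)) →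
                         Through (AvoidsRung (suc j)) c d
  adj-through-avoiding {j} j<k (rung n _) not-p with n ≟ suc j | n ≟ suc (suc j)
  ... | yes refl | _ = ⊥-elim (not-p (inj₁ (refl , refl)))
  ... | no _ | yes refl =
    square j , square-isMatching j (<⇒≤ j<k) , square-avoids-upper j , square-rung U (λ ()) (1+n≢n)
  ... | no n≢p | no n≢1+p =
    square (suc j) , square-isMatching (suc j) j<k , square-avoids-lower (suc j) , square-rung U n≢p n≢1+p
  adj-through-avoiding {j} _ (rail s n n≤k) _ =
    let r , hit = zigzag-rail s n n≤k in zigzag r , zigzag-isMatching r , zigzag-avoids r (suc j) , hit
  adj-through-avoiding {j} _ (w-end s) _ =
    zigzag (op s) , zigzag-isMatching (op s) , zigzag-avoids (op s) (suc j) , zigzag-w-end s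
  adj-through-avoiding {j} _ (z-end s) _ =
    let r , hit = zigzag-z-end s in zigzag r , zigzag-isMatching r , zigzag-avoids r (suc j) , hit
  adj-through-avoiding {j} j<k w-z _ =
    square (suc j) , square-isMatching (suc j) j<k , square-avoids-lower (suc j) , refl

  through-avoiding : ∀ {j c d} → j < k → c ~ d → ¬ SamePair c d (P U (suc j)) (P V (suc j)) →
                     Through (AvoidsRung (suc j)) c d
  through-avoiding j<k (inj₁ e) not-p = adj-through-avoiding j<k e not-p
  through-avoiding j<k (inj₂ e) not-p =
    through-sym (proj₁ (adj-valid e)) (adj-through-avoiding j<k e (not-p ∘ samePair-swap))

module Encoding (k : ℕ) (1≤k : 1 ≤ k) where
  open Ladder k
  open ≡-Reasoning

  G : SVertex k → SVertex k → Set
  G = Staircase k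

  G-sym : ∀ {a b} → G a b → G b a
  G-sym = swap

  enc : SVertex k → Coord
  enc u = P U 0
  enc v = P V 0
  enc w = W
  enc z = Z
  enc x = P U (suc k)
  enc y = P V (suc k)
  enc (ui i) = P U (suc (toℕ i))
  enc (vi i) = P V (suc (toℕ i))

  bottom top : Side → SVertex k
  bottom U = u
  bottom V = v
  top U = x
  top V = y

  inner : Side → Fin k → SVertex k
  inner U = ui
  inner V = vi

  enc-top : ∀ s → enc (top s) ≡ P s (suc k)
  enc-top U = refl
  enc-top V = refl

  enc-inner : ∀ s i → enc (inner s i) ≡ P s (suc (toℕ i))
  enc-inner U i = refl
  enc-inner V i = refl

  dec : Coord → SVertex k
  dec W = w
  dec Z = z
  dec (P s zero) = bottom s
  dec (P s (suc n)) with n <? k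
  ... | yes n<k = inner s (fromℕ< n<k)
  ... | no _ = top s

  dec-enc : ∀ a → dec (enc a) ≡ a
  dec-enc u = refl
  dec-enc v = refl
  dec-enc w = refl
  dec-enc z = refl
  dec-enc x with k <? k
  ... | yes k<k = ⊥-elim (n≮n k k<k)
  ... | no _ = refl
  dec-enc y with k <? k
  ... | yes k<k = ⊥-elim (n≮n k k<k)
  ... | no _ = refl
  dec-enc (ui i) with toℕ i <? k
  ... | yes i<k = cong ui (fromℕ<-toℕ i i<k)
  ... | no i≮k = ⊥-elim (i≮k (toℕ<n i))
  dec-enc (vi i) with toℕ i <? k
  ... | yes i<k = cong vi (fromℕ<-toℕ i i<k)
  ... | no i≮k = ⊥-elim (i≮k (toℕ<n i))

  enc-dec : ∀ {c} → Valid c → enc (dec c) ≡ c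
  enc-dec {W} _ = refl
  enc-dec {Z} _ = refl
  enc-dec {P U zero} _ = refl
  enc-dec {P V zero} _ = refl
  enc-dec {P s (suc n)} (s≤s n≤k) with n <? k
  ... | yes n<k = trans (enc-inner s _) (cong (P s ∘ suc) (toℕ-fromℕ< n<k))
  ... | no n≮k = trans (enc-top s) (cong (P s ∘ suc) (≤-antisym (≮⇒≥ n≮k) n≤k))

  enc-injective : ∀ {a b} → enc a ≡ enc b → a ≡ b
  enc-injective {a} {b} e = begin
    a             ≡⟨ sym (dec-enc a) ⟩
    dec (enc a)   ≡⟨ cong dec e ⟩
    dec (enc b)   ≡⟨ dec-enc b ⟩
    b             ∎

  enc-valid : ∀ a → Valid (enc a)
  enc-valid u = z≤n
  enc-valid v = z≤n
  enc-valid w = tt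
  enc-valid z = tt
  enc-valid x = ≤-refl
  enc-valid y = ≤-refl
  enc-valid (ui i) = s≤s (<⇒≤ (toℕ<n i))
  enc-valid (vi i) = s≤s (<⇒≤ (toℕ<n i))

  enc-base : ∀ {a b} → SBase k a b → enc a ~ enc b
  enc-base e-uv = inj₁ (rung 0 z≤n)
  enc-base e-uw = inj₂ (w-end U)
  enc-base e-vw = inj₂ (w-end V)
  enc-base e-xy = inj₁ (rung (suc k) ≤-refl)
  enc-base e-xz = inj₂ (z-end U)
  enc-base e-yz = inj₂ (z-end V)
  enc-base e-wz = inj₁ w-z
  enc-base (e-rung i) = inj₁ (rung _ (s≤s (<⇒≤ (toℕ<n i))))
  enc-base (e-u-first i i≡0) rewrite i≡0 = inj₁ (rail U 0 z≤n)
  enc-base (e-u-step i j j≡1+i) rewrite j≡1+i = inj₁ (rail U _ (toℕ<n i))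
  enc-base (e-u-last i 1+i≡k) rewrite 1+i≡k = inj₁ (rail U k ≤-refl)
  enc-base (e-v-first i i≡0) rewrite i≡0 = inj₁ (rail V 0 z≤n)
  enc-base (e-v-step i j j≡1+i) rewrite j≡1+i = inj₁ (rail V _ (toℕ<n i))
  enc-base (e-v-last i 1+i≡k) rewrite 1+i≡k = inj₁ (rail V k ≤-refl)

  enc-edge : ∀ {a b} → G a b → enc a ~ enc b
  enc-edge (inj₁ e) = enc-base e
  enc-edge (inj₂ e) = swap (enc-base e)

  dec-adj : ∀ {c d} → Adj c d → G (dec c) (dec d)
  dec-adj (rung zero _) = inj₁ e-uv
  dec-adj (rung (suc n) _) with n <? k
  ... | yes n<k = inj₁ (e-rung (fromℕ< n<k))
  ... | no _ = inj₁ e-xy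
  dec-adj (rail s zero _) with 0 <? k
  dec-adj (rail U zero _) | yes 0<k = inj₁ (e-u-first _ (toℕ-fromℕ< 0<k))
  dec-adj (rail V zero _) | yes 0<k = inj₁ (e-v-first _ (toℕ-fromℕ< 0<k))
  ... | no 0≮k = ⊥-elim (0≮k 1≤k)
  dec-adj (rail s (suc n) 1+n≤k) with n <? k | suc n <? k
  dec-adj (rail U (suc n) _) | yes n<k | yes 1+n<k =
    inj₁ (e-u-step _ _ (trans (toℕ-fromℕ< 1+n<k) (cong suc (sym (toℕ-fromℕ< n<k)))))
  dec-adj (rail V (suc n) _) | yes n<k | yes 1+n<k =
    inj₁ (e-v-step _ _ (trans (toℕ-fromℕ< 1+n<k) (cong suc (sym (toℕ-fromℕ< n<k)))))
  dec-adj (rail U (suc n) 1+n≤k) | yes n<k | no 1+n≮k =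
    inj₁ (e-u-last _ (trans (cong suc (toℕ-fromℕ< n<k)) (≤-antisym 1+n≤k (≮⇒≥ 1+n≮k))))
  dec-adj (rail V (suc n) 1+n≤k) | yes n<k | no 1+n≮k =
    inj₁ (e-v-last _ (trans (cong suc (toℕ-fromℕ< n<k)) (≤-antisym 1+n≤k (≮⇒≥ 1+n≮k))))
  ... | no n≮k | _ = ⊥-elim (n≮k 1+n≤k)
  dec-adj (w-end U) = inj₂ e-uw
  dec-adj (w-end V) = inj₂ e-vw
  dec-adj (z-end s) with k <? k
  ... | yes k<k = ⊥-elim (n≮n k k<k)
  dec-adj (z-end U) | no _ = inj₂ e-xz
  dec-adj (z-end V) | no _ = inj₂ e-yz
  dec-adj w-z = inj₁ e-wz

  dec-edge : ∀ {c d} → c ~ d → G (dec c) (dec d)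
  dec-edge (inj₁ e) = dec-adj e
  dec-edge (inj₂ e) = G-sym (dec-adj e)

  dec-samePair : ∀ {a b c d} → Valid c → Valid d →
                 SamePair (dec c) (dec d) a b → SamePair c d (enc a) (enc b)
  dec-samePair {a} {b} vc vd sp =
    subst₂ (λ c d → SamePair c d (enc a) (enc b)) (enc-dec vc) (enc-dec vd) (samePair-map enc sp)

  dec-deleteEdge : ∀ {a b c d} → c ~ d → ¬ SamePair c d (enc a) (enc b) →
                   DeleteEdge G a b (dec c) (dec d)
  dec-deleteEdge e not-ab = dec-edge e , not-ab ∘ dec-samePair (~-valid (swap e)) (~-valid e)

  encode : (SVertex k → SVertex k) → Coord → Coord
  encode m = enc ∘ m ∘ dec

  encode-isMatching : ∀ {m} → IsPerfectMatching G m → IsMatching (encode m)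
  encode-isMatching {m} (edge , inv) = record { involutive = involutive ; adjacent = adjacent }
    where
    involutive : ∀ c → Valid c → encode m (encode m c) ≡ c
    involutive c vc = begin
      enc (m (dec (enc (m (dec c)))))   ≡⟨ cong (enc ∘ m) (dec-enc (m (dec c))) ⟩
      enc (m (m (dec c)))               ≡⟨ cong enc (inv (dec c)) ⟩
      enc (dec c)                       ≡⟨ enc-dec vc ⟩
      c                                 ∎
    adjacent : ∀ c → Valid c → c ~ encode m c
    adjacent c vc = subst (_~ encode m c) (enc-dec vc) (enc-edge (edge (dec c)))

  encode-avoids : ∀ m {a b} → m a ≢ b → encode m (enc a) ≢ enc b
  encode-avoids m {a} ma≢b e = ma≢b (enc-injective (trans (cong (enc ∘ m) (sym (dec-enc a))) e))

  decode : (Coord → Coord) → SVertex k → SVertex k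
  decode μ = dec ∘ μ ∘ enc

  decode-isPerfectMatching : ∀ {μ} → IsMatching μ → IsPerfectMatching G (decode μ)
  decode-isPerfectMatching {μ} M = edge , involutive
    where
    open IsMatching M using (adjacent)
    edge : ∀ a → G a (decode μ a)
    edge a = subst (λ a′ → G a′ (decode μ a)) (dec-enc a) (dec-edge (adjacent (enc a) (enc-valid a)))
    involutive : ∀ a → decode μ (decode μ a) ≡ a
    involutive a = begin
      dec (μ (enc (dec (μ (enc a)))))   ≡⟨ cong (dec ∘ μ) (enc-dec (~-valid (adjacent (enc a) (enc-valid a)))) ⟩
      dec (μ (μ (enc a)))               ≡⟨ cong dec (IsMatching.involutive M (enc a) (enc-valid a)) ⟩
      dec (enc a)                       ≡⟨ dec-enc a ⟩
      a                                 ∎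

  decode-avoids : ∀ {μ a b} → IsMatching μ → μ (enc a) ≢ enc b → decode μ a ≢ b
  decode-avoids {μ} {a} M μa≢b e =
    μa≢b (trans (sym (enc-dec (~-valid (IsMatching.adjacent M (enc a) (enc-valid a))))) (cong enc e))

  decode-hits : ∀ μ {a b} → μ (enc a) ≡ enc b → decode μ a ≡ b
  decode-hits μ {b = b} hit = trans (cong dec hit) (dec-enc b)

  obstructed : ∀ {a b} → Obstruction (enc a) (enc b) → ¬ MatchingCovered (DeleteEdge G a b)
  obstructed o (_ , covered) =
    let m , pm , hit = covered (dec c′) (dec d′) (dec-deleteEdge edge distinct)
        pmG , ma≢b , mb≢a = perfectMatching-deleteEdge⁻ {E = G} pm
    in blocked (encode-isMatching pmG) (encode-avoids m ma≢b) (encode-avoids m mb≢a)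
               (trans (cong enc hit) (enc-dec (~-valid edge)))
    where open Obstruction o

  removable⇒inner-rung : ∀ {a b} → Removable G a b → ∃ λ i → SamePair a b (ui i) (vi i)
  removable⇒inner-rung {a} {b} (_ , e , mc) with inner-rung-or-obstruction (enc-edge e)
  ... | inj₂ o = ⊥-elim (obstructed o mc)
  ... | inj₁ (n , n<k , sp) = fromℕ< n<k , samePair-injective enc-injective sp′
    where
    sp′ : SamePair (enc a) (enc b) (P U (suc (toℕ (fromℕ< n<k)))) (P V (suc (toℕ (fromℕ< n<k))))
    sp′ = subst (λ j → SamePair (enc a) (enc b) (P U (suc j)) (P V (suc j))) (sym (toℕ-fromℕ< n<k)) sp

  walk-to-w : ∀ i {c} → Valid c → Star (DeleteEdge G (ui i) (vi i)) (dec c) w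
  walk-to-w i {W} _ = ε
  walk-to-w i {Z} _ = dec-deleteEdge (inj₂ w-z) (λ { (inj₁ (() , _)) ; (inj₂ (() , _)) }) ◅ ε
  walk-to-w i {P s zero} _ =
    dec-deleteEdge (inj₂ (w-end s)) (λ { (inj₁ (_ , ())) ; (inj₂ (_ , ())) }) ◅ ε
  walk-to-w i {P s (suc n)} (s≤s n≤k) =
    dec-deleteEdge (inj₂ (rail s n n≤k)) rail-not-rung ◅ walk-to-w i (m≤n⇒m≤1+n n≤k)

  connected-minus-rung : ∀ i → Connected (DeleteEdge G (ui i) (vi i))
  connected-minus-rung i = connected-via (deleteEdge-sym G-sym) w λ a →
    subst (λ a′ → Star (DeleteEdge G (ui i) (vi i)) a′ w) (dec-enc a) (walk-to-w i (enc-valid a))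

  matchingCovered-staircase : MatchingCovered G
  matchingCovered-staircase = connected-mono proj₁ (connected-minus-rung (fromℕ< 1≤k)) , covered
    where
    covered : ∀ a b → G a b → Σ (SVertex k → SVertex k) λ m → IsPerfectMatching G m × m a ≡ b
    covered a b e =
      let μ , M , _ , hit = through (enc-edge e)
      in decode μ , decode-isPerfectMatching M , decode-hits μ hit

  matchingCovered-minus-rung : ∀ i → MatchingCovered (DeleteEdge G (ui i) (vi i))
  matchingCovered-minus-rung i = connected-minus-rung i , covered
    where
    covered : ∀ a b → DeleteEdge G (ui i) (vi i) a b →
              Σ (SVertex k → SVertex k) λ m → IsPerfectMatching (DeleteEdge G (ui i) (vi i)) m × m a ≡ b
    covered a b (e , not-rung) =
      let μ , M , avoids , hit = through-avoiding (toℕ<n i) (enc-edge e)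
                                   (not-rung ∘ samePair-injective enc-injective)
      in decode μ ,
         perfectMatching-deleteEdge {E = G} (decode-isPerfectMatching M) (decode-avoids {a = ui i} {b = vi i} M avoids) ,
         decode-hits μ hit

  rung-removable : ∀ i → Removable G (ui i) (vi i)
  rung-removable i = matchingCovered-staircase , inj₁ (e-rung i) , matchingCovered-minus-rung i

  inner-rung⇒removable : ∀ {a b} → (∃ λ i → SamePair a b (ui i) (vi i)) → Removable G a b
  inner-rung⇒removable (i , inj₁ (refl , refl)) = rung-removable i
  inner-rung⇒removable (i , inj₂ (refl , refl)) = removable-sym G-sym (rung-removable i)

proposition4p6 : (k : ℕ) → 1 ≤ k → (a b : SVertex k) →
    Removable (Staircase k) a b ⇔ ∃ (λ (i : Fin k) → SamePair a b (ui i) (vi i))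
proposition4p6 k 1≤k a b = mk⇔ removable⇒inner-rung inner-rung⇒removable
  where open Encoding k 1≤k
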